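{- Let $T$ be a tree. If $\gamma_{\{R2\}}(T)=\gamma(T)+1$, then $i_{\{R2\}}(T)=\gamma_{\{R2\}}(T)$ and $i(T)=\gamma(T)$.
   Context: $\gamma(T)$ is the domination number and $i(T)$ the independent domination number (minimum size of an independent dominating set) of $T$. A Roman $\{2\}$-dominating function on a graph $G=(V,E)$ is a function $f:V\to\{0,1,2\}$ such that every $v$ with $f(v)=0$ satisfies $\sum_{u\in N(v)}f(u)\ge 2$; its weight is $\sum_v f(v)$. $\gamma_{\{R2\}}(G)$ is the minimum weight of such a function, and $i_{\{R2\}}(G)$ is the minimum weight of such a function $f$ for which $\{v:f(v)>0\}$ is an independent set. -}

module Defs where

open import Data.Bool using (Bool; true; false; if_then_else_)
open import Data.Nat using (ℕ; _+_; _≤_; _<_)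
open import Data.Fin using (Fin)
open import Data.List using (List; []; _∷_; length; map; allFin; last)
open import Data.Nat.ListAction using (sum)
open import Data.List.Relation.Unary.Unique.Propositional using (Unique)
open import Data.Maybe using (just)
open import Data.Product using (_×_; ∃-syntax)
open import Relation.Binary.PropositionalEquality using (_≡_)
open import Relation.Nullary using (¬_)

record Graph (n : ℕ) : Set where
  field
    adj    : Fin n → Fin n → Bool
    sym    : ∀ u v → adj u v ≡ adj v u
    irrefl : ∀ v → adj v v ≡ false

open Graph public

Adj : ∀ {n} → Graph n → Fin n → Fin n → Set
Adj G u v = adj G u v ≡ true

data Walk {n : ℕ} (G : Graph n) : Fin n → Fin n → Set where
  here : ∀ {v} → Walk G v v
  step : ∀ {u w v} → Adj G u w → Walk G w v → Walk G u v

Connected : ∀ {n} → Graph n → Set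
Connected G = ∀ u v → Walk G u v

data Path {n : ℕ} (G : Graph n) : List (Fin n) → Set where
  single : ∀ {v} → Path G (v ∷ [])
  cons   : ∀ {u v vs} → Adj G u v → Path G (v ∷ vs) → Path G (u ∷ v ∷ vs)

HasCycle : ∀ {n} → Graph n → Set
HasCycle {n} G = ∃[ x ] ∃[ xs ] ∃[ y ]
  (3 ≤ length (x ∷ xs) × Unique (x ∷ xs) × Path G (x ∷ xs)
   × last (x ∷ xs) ≡ just y × Adj G y x)

IsTree : ∀ {n} → Graph n → Set
IsTree {n} G = 1 ≤ n × Connected G × ¬ HasCycle G

Σᵥ : ∀ {n} → (Fin n → ℕ) → ℕ
Σᵥ {n} f = sum (map f (allFin n))

Subset : ℕ → Set
Subset n = Fin n → Bool

size : ∀ {n} → Subset n → ℕ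
size S = Σᵥ (λ v → if S v then 1 else 0)

module _ {n : ℕ} (G : Graph n) where

  Dominating : Subset n → Set
  Dominating S = ∀ v → S v ≡ false → ∃[ u ] (Adj G v u × S u ≡ true)

  Independent : Subset n → Set
  Independent S = ∀ u v → S u ≡ true → S v ≡ true → ¬ Adj G u v

  nbrSum : (Fin n → ℕ) → Fin n → ℕ
  nbrSum f v = Σᵥ (λ u → if adj G v u then f u else 0)

  weight : (Fin n → ℕ) → ℕ
  weight f = Σᵥ f

  IsR2DF : (Fin n → ℕ) → Set
  IsR2DF f = (∀ v → f v ≤ 2) × (∀ v → f v ≡ 0 → 2 ≤ nbrSum f v)

  PositiveIndependent : (Fin n → ℕ) → Set
  PositiveIndependent f = ∀ u v → 0 < f u → 0 < f v → ¬ Adj G u v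

  IsIR2DF : (Fin n → ℕ) → Set
  IsIR2DF f = IsR2DF f × PositiveIndependent f

  IsDominationNumber : ℕ → Set
  IsDominationNumber k =
    (∃[ S ] (Dominating S × size S ≡ k)) ×
    (∀ S → Dominating S → k ≤ size S)

  IsIndepDominationNumber : ℕ → Set
  IsIndepDominationNumber k =
    (∃[ S ] (Dominating S × Independent S × size S ≡ k)) ×
    (∀ S → Dominating S → Independent S → k ≤ size S)

  IsR2DominationNumber : ℕ → Set
  IsR2DominationNumber k =
    (∃[ f ] (IsR2DF f × weight f ≡ k)) ×
    (∀ f → IsR2DF f → k ≤ weight f)

  IsIndepR2DominationNumber : ℕ → Set
  IsIndepR2DominationNumber k =
    (∃[ f ] (IsIR2DF f × weight f ≡ k)) ×
    (∀ f → IsIR2DF f → k ≤ weight f)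

module Submission where

-- An independent R2DF is an R2DF and an independent dominating set is
-- dominating, so the lower bounds are inherited and it suffices to exhibit an
-- independent R2DF of weight γ + 1 and an independent dominating set of size γ.
-- Starting from any R2DF f of weight γ + 1 (and using only that dominating
-- sets have at least γ vertices):
--  * if f takes the value 2 somewhere, w(f) = |V⁺| + |V₂| forces V⁺ to be a
--    minimum dominating set, and minimality forces V⁺ to be independent
--    (this holds in every graph);
--  * if f takes values in {0, 1}, root the tree. An edge between two positive
--    vertices either allows moving weight so that a value 2 appears, or it
--    contradicts a count comparing |V⁰| with the weight of f below parents of
--    value 0; if V⁺ is independent, the same count shows that V⁰ is an
--    independent dominating set of size γ.

open import Defs hiding (sym)
open import Data.Nat using (ℕ; zero; suc; _+_; _≤_; _<_; z≤n; s≤s; _≡ᵇ_)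
import Data.Nat as ℕ
open import Data.Nat.Properties hiding (_≟_)
open import Data.Bool using (Bool; true; false; if_then_else_; _∧_; _∨_; not)
import Data.Bool.Properties as Boolₚ
open import Data.Fin using (Fin; zero; suc)
open import Data.Fin.Properties using (_≟_; any?)
open import Data.List using (List; []; _∷_)
open import Data.List.Properties using (map-tabulate)
open import Data.Nat.ListAction using (sum)
open import Data.Product using (∃-syntax; _×_; _,_; proj₁; proj₂)
open import Data.Sum using (_⊎_; inj₁; inj₂)
open import Data.Empty using (⊥; ⊥-elim)
open import Function using (id; _∘_)
open import Relation.Binary.PropositionalEquality
open import Relation.Nullary using (¬_; Dec; yes; no; does; contradiction)
open import Relation.Nullary.Decidable using (_×-dec_; _⊎-dec_)

𝟙 : Bool → ℕ
𝟙 b = if b then 1 else 0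

module VertexSums where

  Σᵥ-suc : ∀ {n} (g : Fin (suc n) → ℕ) → Σᵥ g ≡ g zero + Σᵥ (λ v → g (suc v))
  Σᵥ-suc g = cong (g zero +_) (cong sum
    (trans (map-tabulate suc g) (sym (map-tabulate id (λ v → g (suc v))))))

  Σ-cong : ∀ {n} {g h : Fin n → ℕ} → (∀ v → g v ≡ h v) → Σᵥ g ≡ Σᵥ h
  Σ-cong {zero} p = refl
  Σ-cong {suc n} {g} {h} p
    rewrite Σᵥ-suc g | Σᵥ-suc h = cong₂ _+_ (p zero) (Σ-cong (λ v → p (suc v)))

  Σ-mono : ∀ {n} {g h : Fin n → ℕ} → (∀ v → g v ≤ h v) → Σᵥ g ≤ Σᵥ h
  Σ-mono {zero} p = z≤n
  Σ-mono {suc n} {g} {h} p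
    rewrite Σᵥ-suc g | Σᵥ-suc h = +-mono-≤ (p zero) (Σ-mono (λ v → p (suc v)))

  Σ-zero : ∀ {n} → Σᵥ {n} (λ _ → 0) ≡ 0
  Σ-zero {zero} = refl
  Σ-zero {suc n} = trans (Σᵥ-suc {n} (λ _ → 0)) (Σ-zero {n})

  Σ-+ : ∀ {n} (g h : Fin n → ℕ) → Σᵥ (λ v → g v + h v) ≡ Σᵥ g + Σᵥ h
  Σ-+ {zero} g h = refl
  Σ-+ {suc n} g h
    rewrite Σᵥ-suc (λ v → g v + h v) | Σᵥ-suc g | Σᵥ-suc h
          | Σ-+ (λ v → g (suc v)) (λ v → h (suc v)) =
    +-+-interchange (g zero) (h zero) _ _
    where open import Algebra.Properties.CommutativeSemigroup +-commutativeSemigroup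
            using () renaming (interchange to +-+-interchange)

  Σ-mono-+ : ∀ {n} {g h k : Fin n → ℕ} → (∀ v → g v + h v ≤ k v) → Σᵥ g + Σᵥ h ≤ Σᵥ k
  Σ-mono-+ {g = g} {h} p = subst (_≤ _) (Σ-+ g h) (Σ-mono p)

  Σ-point : ∀ {n} (a : Fin n) (g : Fin n → ℕ) →
            Σᵥ (λ v → if does (a ≟ v) then g v else 0) ≡ g a
  Σ-point {suc n} zero g
    rewrite Σᵥ-suc (λ v → if does (zero ≟ v) then g v else 0) | Σ-zero {n} = +-identityʳ (g zero)
  Σ-point {suc n} (suc a) g
    rewrite Σᵥ-suc (λ v → if does (suc a ≟ v) then g v else 0) = Σ-point a (λ v → g (suc v))

  Σ-swap : ∀ {m n} (F : Fin m → Fin n → ℕ) →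
           Σᵥ (λ x → Σᵥ (λ u → F x u)) ≡ Σᵥ (λ u → Σᵥ (λ x → F x u))
  Σ-swap {zero} {n} F = sym (Σ-zero {n})
  Σ-swap {suc m} F = begin
      Σᵥ (λ x → Σᵥ (F x))
    ≡⟨ Σᵥ-suc (λ x → Σᵥ (F x)) ⟩
      Σᵥ (F zero) + Σᵥ (λ x → Σᵥ (F (suc x)))
    ≡⟨ cong (Σᵥ (F zero) +_) (Σ-swap (λ x → F (suc x))) ⟩
      Σᵥ (F zero) + Σᵥ (λ u → Σᵥ (λ x → F (suc x) u))
    ≡⟨ sym (Σ-+ (F zero) (λ u → Σᵥ (λ x → F (suc x) u))) ⟩
      Σᵥ (λ u → F zero u + Σᵥ (λ x → F (suc x) u))
    ≡⟨ Σ-cong (λ u → sym (Σᵥ-suc (λ x → F x u))) ⟩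
      Σᵥ (λ u → Σᵥ (λ x → F x u))
    ∎
    where open ≡-Reasoning

  Σ-fibres : ∀ {m n} (p : Fin m → Fin n) (H : Fin n → Bool) (g : Fin m → ℕ) →
             Σᵥ (λ x → if H x then Σᵥ (λ u → if does (p u ≟ x) then g u else 0) else 0)
             ≡ Σᵥ (λ u → if H (p u) then g u else 0)
  Σ-fibres {m} p H g = begin
      Σᵥ (λ x → if H x then Σᵥ (λ u → if does (p u ≟ x) then g u else 0) else 0)
    ≡⟨ Σ-cong restrict ⟩
      Σᵥ (λ x → Σᵥ (λ u → F x u))
    ≡⟨ Σ-swap F ⟩
      Σᵥ (λ u → Σᵥ (λ x → F x u))
    ≡⟨ Σ-cong (λ u → Σ-point (p u) (λ x → if H x then g u else 0)) ⟩
      Σᵥ (λ u → if H (p u) then g u else 0)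
    ∎
    where
      open ≡-Reasoning
      F : _ → _ → ℕ
      F x u = if does (p u ≟ x) then (if H x then g u else 0) else 0
      restrict : ∀ x → (if H x then Σᵥ (λ u → if does (p u ≟ x) then g u else 0) else 0)
                       ≡ Σᵥ (λ u → F x u)
      restrict x with H x
      ... | true = refl
      ... | false = sym (trans (Σ-cong (λ u → vanish (does (p u ≟ x)))) (Σ-zero {m}))
        where
          vanish : ∀ b → (if b then 0 else 0) ≡ 0
          vanish true = refl
          vanish false = refl

open VertexSums

module VertexSets {n : ℕ} where

  ⁅_⁆ : Fin n → Subset n
  ⁅ a ⁆ v = does (a ≟ v)

  _─_ : Subset n → Fin n → Subset n
  (S ─ a) v = S v ∧ not (does (a ≟ v))

  size-⁅⁆ : ∀ a → size ⁅ a ⁆ ≡ 1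
  size-⁅⁆ a = Σ-point a (λ _ → 1)

  size-pos : ∀ {S a} → S a ≡ true → 1 ≤ size S
  size-pos {S} {a} Sa = subst (_≤ size S) (size-⁅⁆ a) (Σ-mono pointwise)
    where
      pointwise : ∀ v → 𝟙 (⁅ a ⁆ v) ≤ 𝟙 (S v)
      pointwise v with a ≟ v
      ... | yes refl rewrite Sa = ≤-refl
      ... | no _ = z≤n

  size-grow : ∀ {S T a} → (∀ v → S v ≡ true → T v ≡ true) → S a ≡ false → T a ≡ true →
              size S + 1 ≤ size T
  size-grow {S} {T} {a} S⊆T Sa Ta =
    subst (λ k → size S + k ≤ size T) (size-⁅⁆ a) (Σ-mono-+ pointwise)
    where
      pointwise : ∀ v → 𝟙 (S v) + 𝟙 (⁅ a ⁆ v) ≤ 𝟙 (T v)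
      pointwise v with a ≟ v
      ... | yes refl rewrite Sa | Ta = ≤-refl
      ... | no _ with S v in Sv
      ...   | true rewrite S⊆T v Sv = ≤-refl
      ...   | false = z≤n

  size-∪ : ∀ (S T : Subset n) → size (λ v → S v ∨ T v) ≤ size S + size T
  size-∪ S T = subst (size (λ v → S v ∨ T v) ≤_) (Σ-+ (λ v → 𝟙 (S v)) (λ v → 𝟙 (T v)))
                     (Σ-mono pointwise)
    where
      pointwise : ∀ v → 𝟙 (S v ∨ T v) ≤ 𝟙 (S v) + 𝟙 (T v)
      pointwise v with S v
      ... | true = s≤s z≤n
      ... | false = ≤-refl

  ─-member : ∀ {S a v} → S v ≡ true → a ≢ v → (S ─ a) v ≡ true
  ─-member {a = a} {v} Sv a≢v with a ≟ v
  ... | yes a≡v = contradiction a≡v a≢v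
  ... | no _ rewrite Sv = refl

  ─-nonmember : ∀ {S a v} → (S ─ a) v ≡ false → S v ≡ false ⊎ a ≡ v
  ─-nonmember {S} {a} {v} eq with a ≟ v
  ... | yes a≡v = inj₂ a≡v
  ... | no _ = inj₁ (trans (sym (Boolₚ.∧-identityʳ (S v))) eq)

  size-─ : ∀ {S a} → S a ≡ true → size (S ─ a) + 1 ≤ size S
  size-─ {S} {a} Sa = size-grow S─a⊆S a∉S─a Sa
    where
      S─a⊆S : ∀ v → (S ─ a) v ≡ true → S v ≡ true
      S─a⊆S v eq with S v
      ... | true = refl
      a∉S─a : (S ─ a) a ≡ false
      a∉S─a with a ≟ a
      ... | yes _ = Boolₚ.∧-zeroʳ (S a)
      ... | no a≢a = contradiction refl a≢a

open VertexSets

dominated? : ∀ {n} (G : Graph n) (S : Subset n) v → Dec (∃[ u ] (Adj G v u × S u ≡ true))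
dominated? G S v = any? (λ u → (adj G v u Boolₚ.≟ true) ×-dec (S u Boolₚ.≟ true))

adj-irrefl : ∀ {n} (G : Graph n) {u v} → Adj G u v → u ≢ v
adj-irrefl G {u} uv refl with trans (sym uv) (irrefl G u)
... | ()

adj-sym : ∀ {n} (G : Graph n) {u v} → Adj G u v → Adj G v u
adj-sym G {u} {v} uv = trans (Graph.sym G v u) uv

module NeighbourSums {n : ℕ} (G : Graph n) where

  nbrSum-mono : ∀ {g h} v → (∀ u → Adj G v u → g u ≤ h u) → nbrSum G g v ≤ nbrSum G h v
  nbrSum-mono {g} {h} v g≤h = Σ-mono pointwise
    where
      pointwise : ∀ u → (if adj G v u then g u else 0) ≤ (if adj G v u then h u else 0)
      pointwise u with adj G v u in vu
      ... | true = g≤h u vu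
      ... | false = z≤n

  nbrSum-≤-Σ : ∀ g v → nbrSum G g v ≤ Σᵥ g
  nbrSum-≤-Σ g v = Σ-mono pointwise
    where
      pointwise : ∀ u → (if adj G v u then g u else 0) ≤ g u
      pointwise u with adj G v u
      ... | true = ≤-refl
      ... | false = z≤n

  nbrSum-≥ : ∀ g {v u} → Adj G v u → g u ≤ nbrSum G g v
  nbrSum-≥ g {v} {u} vu = subst (_≤ nbrSum G g v) (Σ-point u g) (Σ-mono pointwise)
    where
      pointwise : ∀ w → (if does (u ≟ w) then g w else 0) ≤ (if adj G v w then g w else 0)
      pointwise w with u ≟ w
      ... | yes refl rewrite vu = ≤-refl
      ... | no _ = z≤n

  nbrSum-undominated : ∀ {g h : Fin n → ℕ} {S : Subset n} {v} → ¬ (∃[ u ] (Adj G v u × S u ≡ true)) →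
                       (∀ u → S u ≡ false → g u ≤ h u) → nbrSum G g v ≤ Σᵥ h
  nbrSum-undominated {g} {h} {S} {v} undominated g≤h =
    ≤-trans (nbrSum-mono v bound) (nbrSum-≤-Σ h v)
    where
      bound : ∀ u → Adj G v u → g u ≤ h u
      bound u vu with S u in Su
      ... | true = contradiction (u , vu , Su) undominated
      ... | false = g≤h u Su

open NeighbourSums

positive : ℕ → Bool
positive zero = false
positive (suc _) = true

positive-false : ∀ {x} → positive x ≡ false → x ≡ 0
positive-false {zero} _ = refl

positive-true : ∀ {x} → 0 < x → positive x ≡ true
positive-true {suc _} _ = refl

module _ {n : ℕ} (f : Fin n → ℕ) where

  support : Subset n
  support v = positive (f v)

  zeros : Subset n
  zeros v = not (positive (f v))

  twos : Subset n
  twos v = f v ≡ᵇ 2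

module RomanFacts {n : ℕ} (G : Graph n) where

  -- A vertex of value 0 with no positive neighbour has N_f(v) = 0, so V⁺ dominates.
  support-dominating : ∀ {f} → IsR2DF G f → Dominating G (support f)
  support-dominating {f} (_ , cover) v v∉ with dominated? G (support f) v
  ... | yes dominated = dominated
  ... | no undominated = contradiction
          (≤-trans (cover v (positive-false v∉))
            (≤-trans (nbrSum-undominated G undominated (λ u → ≤-reflexive ∘ positive-false))
                     (≤-reflexive (Σ-zero {n}))))
          λ ()

  weight-support-twos : ∀ {f} → (∀ v → f v ≤ 2) →
                        weight G f ≡ size (support f) + size (twos f)
  weight-support-twos {f} f≤2 =
    trans (Σ-cong split) (Σ-+ (λ v → 𝟙 (support f v)) (λ v → 𝟙 (twos f v)))
    where
      split : ∀ v → f v ≡ 𝟙 (support f v) + 𝟙 (twos f v)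
      split v with f v | f≤2 v
      ... | 0 | _ = refl
      ... | 1 | _ = refl
      ... | 2 | _ = refl
      ... | suc (suc (suc _)) | s≤s (s≤s ())

  -- Deleting from V⁺ a vertex a with f a ≤ 1 that has a positive neighbour c
  -- leaves a dominating set: a is dominated by c, and a vertex of value 0 that
  -- relied on a alone would have N_f(v) ≤ f a ≤ 1.
  support-minus-dominating : ∀ {f a c} → IsR2DF G f → f a ≤ 1 → Adj G a c →
                             support f c ≡ true → Dominating G (support f ─ a)
  support-minus-dominating {f} {a} {c} (_ , cover) fa≤1 ac c⁺ v v∉ with dominated? G (support f ─ a) v
  ... | yes dominated = dominated
  ... | no undominated with ─-nonmember {S = support f} {a} v∉
  ...   | inj₂ refl = contradiction (c , ac , ─-member {S = support f} c⁺ (adj-irrefl G ac)) undominated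
  ...   | inj₁ v⁰ = contradiction
            (≤-trans (cover v (positive-false v⁰))
              (≤-trans (nbrSum-undominated G undominated only-a) (≤-reflexive (Σ-point a f))))
            (λ 2≤ → contradiction (≤-trans 2≤ fa≤1) λ { (s≤s ()) })
    where
      only-a : ∀ u → (support f ─ a) u ≡ false → f u ≤ (if does (a ≟ u) then f u else 0)
      only-a u u∉ with a ≟ u | ─-nonmember {S = support f} {a} u∉
      ... | yes _ | _ = ≤-refl
      ... | no _ | inj₁ u⁰ = ≤-reflexive (positive-false u⁰)
      ... | no a≢u | inj₂ a≡u = contradiction a≡u a≢u

open RomanFacts

least : ∀ {P : ℕ → Set} → (∀ k → Dec (P k)) → ∀ {k} → P k →
        ∃[ m ] (P m × (∀ {j} → P j → m ≤ j))
least P? {zero} p = 0 , p , λ _ → z≤n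
least P? {suc k} p with P? 0
... | yes p₀ = 0 , p₀ , λ _ → z≤n
... | no ¬p₀ with least (λ j → P? (suc j)) p
...   | m , pm , minimal = suc m , pm , λ { {zero} p₀ → contradiction p₀ ¬p₀ ; {suc j} pj → s≤s (minimal pj) }

module Snoc where
  open import Data.List using (_++_; last)
  open import Data.Maybe using (just)
  open import Data.List.Relation.Unary.All using (All)
  open import Data.List.Relation.Unary.Unique.Propositional using (Unique)
  import Data.List.Relation.Unary.All as All
  import Data.List.Relation.Unary.AllPairs.Properties as AllPairs
  open import Data.List.Relation.Unary.AllPairs using ([]; _∷_)

  last-snoc : ∀ {A : Set} (x : A) xs z → last ((x ∷ xs) ++ z ∷ []) ≡ just z
  last-snoc x [] z = refl
  last-snoc x (y ∷ ys) z = last-snoc y ys z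

  path-snoc : ∀ {n} {G : Graph n} {xs y z} → Path G xs → last xs ≡ just y → Adj G y z →
              Path G (xs ++ z ∷ [])
  path-snoc single refl yz = cons yz single
  path-snoc (cons xy p) ends yz = cons xy (path-snoc p ends yz)

  unique-snoc : ∀ {A : Set} {xs : List A} {z} → Unique xs → All (_≢ z) xs → Unique (xs ++ z ∷ [])
  unique-snoc distinct fresh = AllPairs.++⁺ distinct (All.[] ∷ []) (All.map (All._∷ All.[]) fresh)

record Rooting {n : ℕ} (G : Graph n) (r : Fin n) : Set where
  field
    parent      : Fin n → Fin n
    parent-root : parent r ≡ r
    parent-adj  : ∀ {v} → v ≢ r → Adj G v (parent v)
    edge-parent : ∀ {u v} → Adj G u v → u ≡ parent v ⊎ v ≡ parent u

module Distances {n : ℕ} (G : Graph n) (conn : Connected G) (r : Fin n) where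

  Near : ℕ → Fin n → Set
  Near zero v = v ≡ r
  Near (suc k) v = Near k v ⊎ ∃[ u ] (Adj G v u × Near k u)

  near? : ∀ k v → Dec (Near k v)
  near? zero v = v ≟ r
  near? (suc k) v = near? k v ⊎-dec any? (λ u → (adj G v u Boolₚ.≟ true) ×-dec near? k u)

  walkLength : ∀ {u v} → Walk G u v → ℕ
  walkLength here = 0
  walkLength (step _ w) = suc (walkLength w)

  walk-near : ∀ {v} (w : Walk G v r) → Near (walkLength w) v
  walk-near here = refl
  walk-near (step vu w) = inj₂ (_ , vu , walk-near w)

  dist : Fin n → ℕ
  dist v = proj₁ (least (λ k → near? k v) (walk-near (conn v r)))

  dist-near : ∀ v → Near (dist v) v
  dist-near v = proj₁ (proj₂ (least (λ k → near? k v) (walk-near (conn v r))))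

  dist-least : ∀ {v k} → Near k v → dist v ≤ k
  dist-least {v} = proj₂ (proj₂ (least (λ k → near? k v) (walk-near (conn v r))))

  dist-zero : ∀ {v} → dist v ≡ 0 → v ≡ r
  dist-zero {v} eq = subst (λ k → Near k v) eq (dist-near v)

  dist-root : dist r ≡ 0
  dist-root = n≤0⇒n≡0 (dist-least {k = 0} refl)

  dist-edge : ∀ {u v} → Adj G u v → dist v ≤ suc (dist u)
  dist-edge {u} uv = dist-least (inj₂ (u , adj-sym G uv , dist-near u))

  dist-step : ∀ {v k} → dist v ≡ suc k → ∃[ u ] (Adj G v u × suc (dist u) ≡ dist v)
  dist-step {v} {k} eq with subst (λ j → Near j v) eq (dist-near v)
  ... | inj₁ near = contradiction (subst (_≤ k) eq (dist-least near)) 1+n≰n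
  ... | inj₂ (u , vu , near) = u , vu , trans (cong suc du≡k) (sym eq)
    where
      du≡k : dist u ≡ k
      du≡k = ≤-antisym (dist-least near) (≤-pred (subst (_≤ suc (dist u)) eq (dist-edge (adj-sym G vu))))

-- A connected acyclic graph can be rooted at any vertex: every v ≠ r has a
-- unique neighbour one step closer to r (two of them, or an edge inside a
-- distance level, would close a cycle through the levels below).
module TreeRooting {n : ℕ} (G : Graph n) (conn : Connected G) (acyclic : ¬ HasCycle G) (r : Fin n) where
  open Distances G conn r
  open Snoc
  open import Data.List using (_++_; last; length)
  open import Data.List.Properties using (length-++)
  open import Data.Maybe using (just)
  open import Data.List.Relation.Unary.All using (All; []; _∷_)
  import Data.List.Relation.Unary.All as All
  open import Data.List.Relation.Unary.All.Properties using (∷ʳ⁺)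
  open import Data.List.Relation.Unary.AllPairs using ([]; _∷_)
  open import Data.List.Relation.Unary.Unique.Propositional using (Unique)
  open import Relation.Binary.Definitions using (tri<; tri≈; tri>)

  IsParent : Fin n → Fin n → Set
  IsParent v u = Adj G v u × suc (dist u) ≡ dist v

  isParent? : ∀ v u → Dec (IsParent v u)
  isParent? v u = (adj G v u Boolₚ.≟ true) ×-dec (suc (dist u) ℕ.≟ dist v)

  parent : Fin n → Fin n
  parent v with any? (isParent? v)
  ... | yes (u , _) = u
  ... | no _ = v

  parent-spec : ∀ {v} → v ≢ r → IsParent v (parent v)
  parent-spec {v} v≢r with any? (isParent? v)
  ... | yes (_ , isParent) = isParent
  ... | no none = contradiction (closer-neighbour (dist v) refl) none
    where
      closer-neighbour : ∀ k → dist v ≡ k → ∃[ u ] IsParent v u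
      closer-neighbour zero eq = contradiction (dist-zero eq) v≢r
      closer-neighbour (suc k) eq = dist-step eq

  parent-root : parent r ≡ r
  parent-root with any? (isParent? r)
  ... | yes (_ , _ , closer) = contradiction (trans closer dist-root) λ ()
  ... | no _ = refl

  record LowPath (m : ℕ) (p q : Fin n) : Set where
    field
      rest     : List (Fin n)
      path     : Path G (p ∷ rest)
      distinct : Unique (p ∷ rest)
      ends     : last (p ∷ rest) ≡ just q
      low      : All (λ x → dist x ≤ m) (p ∷ rest)

  LongPath : ℕ → Fin n → Fin n → Set
  LongPath m p q = ∃[ P ] (2 ≤ length (LowPath.rest {m} {p} {q} P))

  above : ∀ {m x xs} → dist x ≡ suc m → All (λ y → dist y ≤ m) xs → All (x ≢_) xs
  above dx = All.map λ dy≤m x≡y → 1+n≰n (subst (_≤ _) (trans (cong dist (sym x≡y)) dx) dy≤m)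

  extend : ∀ {m p p′ q′ q} → LowPath m p′ q′ → Adj G p p′ → Adj G q′ q →
           dist p ≡ suc m → dist q ≡ suc m → p ≢ q → LongPath (suc m) p q
  extend {m} {p} {p′} {q′} {q} P pp′ q′q dp dq p≢q =
    record
      { rest = (p′ ∷ rest) ++ q ∷ []
      ; path = cons pp′ (path-snoc path ends q′q)
      ; distinct = ∷ʳ⁺ (above dp low) p≢q ∷ unique-snoc distinct (All.map (λ q≢x x≡q → q≢x (sym x≡q)) (above dq low))
      ; ends = last-snoc p′ rest q
      ; low = ≤-reflexive dp ∷ ∷ʳ⁺ (All.map m≤n⇒m≤1+n low) (≤-reflexive dq)
      }
    , s≤s (subst (1 ≤_) (sym (trans (length-++ rest) (+-comm (length rest) 1))) (s≤s z≤n))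
    where open LowPath P

  mutual
    connect : ∀ m {p q} → dist p ≡ m → dist q ≡ m → LowPath m p q
    connect m {p} {q} dp dq with p ≟ q
    ... | yes refl = record { rest = [] ; path = single ; distinct = [] ∷ [] ; ends = refl ; low = ≤-reflexive dp ∷ [] }
    ... | no p≢q = proj₁ (connect-distinct m dp dq p≢q)

    connect-distinct : ∀ m {p q} → dist p ≡ m → dist q ≡ m → p ≢ q → LongPath m p q
    connect-distinct zero dp dq p≢q = contradiction (trans (dist-zero dp) (sym (dist-zero dq))) p≢q
    connect-distinct (suc m) {p} {q} dp dq p≢q =
      extend (connect m (level p dp) (level q dq)) (proj₁ (parent-spec (off-root p dp)))
             (adj-sym G (proj₁ (parent-spec (off-root q dq)))) dp dq p≢q
      where
        off-root : ∀ x → dist x ≡ suc m → x ≢ r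
        off-root x dx refl = contradiction (trans (sym dx) dist-root) λ ()
        level : ∀ x → dist x ≡ suc m → dist (parent x) ≡ m
        level x dx = suc-injective (trans (proj₂ (parent-spec (off-root x dx))) dx)

  no-level-edge : ∀ {u v} → Adj G u v → dist u ≢ dist v
  no-level-edge {u} {v} uv du≡dv with connect-distinct (dist u) refl (sym du≡dv) (adj-irrefl G uv)
  ... | P , long = acyclic (u , rest , v , s≤s long , distinct , path , ends , adj-sym G uv)
    where open LowPath P

  unique-parent : ∀ {v p q} → IsParent v p → IsParent v q → p ≡ q
  unique-parent {v} {p} {q} (vp , dp) (vq , dq) with p ≟ q
  ... | yes p≡q = p≡q
  ... | no p≢q with connect-distinct (dist p) refl (suc-injective (trans dq (sym dp))) p≢q
  ...   | P , long = ⊥-elim (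
    acyclic (v , p ∷ rest , q , s≤s (s≤s (≤-trans (s≤s z≤n) long)) ,
             above (sym dp) low ∷ distinct , cons vp path , ends , adj-sym G vq))
    where open LowPath P

  lower-neighbour-is-parent : ∀ {u v} → Adj G v u → dist u < dist v → u ≡ parent v
  lower-neighbour-is-parent {u} {v} vu du<dv =
    unique-parent (vu , ≤-antisym du<dv (dist-edge (adj-sym G vu))) (parent-spec v≢r)
    where
      v≢r : v ≢ r
      v≢r refl = contradiction (subst (dist u <_) dist-root du<dv) λ ()

  rooting : Rooting G r
  rooting = record
    { parent = parent
    ; parent-root = parent-root
    ; parent-adj = λ v≢r → proj₁ (parent-spec v≢r)
    ; edge-parent = edge-parent
    }
    where
      edge-parent : ∀ {u v} → Adj G u v → u ≡ parent v ⊎ v ≡ parent u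
      edge-parent {u} {v} uv with <-cmp (dist u) (dist v)
      ... | tri< du<dv _ _ = inj₁ (lower-neighbour-is-parent (adj-sym G uv) du<dv)
      ... | tri≈ _ du≡dv _ = contradiction du≡dv (no-level-edge uv)
      ... | tri> _ _ dv<du = inj₂ (lower-neighbour-is-parent uv dv<du)

module RootedSums {n : ℕ} {G : Graph n} {r : Fin n} (R : Rooting G r) where
  open Rooting R

  -- The total g-value of the children of x (for x = r this includes r itself).
  childSum : (Fin n → ℕ) → Fin n → ℕ
  childSum g x = Σᵥ (λ u → if does (parent u ≟ x) then g u else 0)

  nbrSum-parent-children : ∀ g x → nbrSum G g x ≤ g (parent x) + childSum g x
  nbrSum-parent-children g x =
    subst (nbrSum G g x ≤_)
      (trans (Σ-+ (λ u → if does (parent x ≟ u) then g u else 0) _)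
             (cong (_+ childSum g x) (Σ-point (parent x) g)))
      (Σ-mono pointwise)
    where
      pointwise : ∀ u → (if adj G x u then g u else 0) ≤
                        (if does (parent x ≟ u) then g u else 0) + (if does (parent u ≟ x) then g u else 0)
      pointwise u with adj G x u in xu
      ... | false = z≤n
      ... | true with edge-parent xu
      ...   | inj₁ x≡parent-u rewrite x≡parent-u with parent u ≟ parent u
      ...     | yes _ = m≤n+m (g u) _
      ...     | no ≢ = contradiction refl ≢
      pointwise u | true | inj₂ u≡parent-x rewrite u≡parent-x with parent x ≟ parent x
      ...     | yes _ = m≤m+n (g (parent x)) _
      ...     | no ≢ = contradiction refl ≢

_[_≔_] : ∀ {n} → (Fin n → ℕ) → Fin n → ℕ → Fin n → ℕ
(f [ a ≔ k ]) v = if does (a ≟ v) then k else f v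

weight-update : ∀ {n} (f : Fin n → ℕ) a k → Σᵥ (f [ a ≔ k ]) + f a ≡ Σᵥ f + k
weight-update f a k = begin
    Σᵥ (f [ a ≔ k ]) + f a
  ≡⟨ cong (Σᵥ (f [ a ≔ k ]) +_) (sym (Σ-point a f)) ⟩
    Σᵥ (f [ a ≔ k ]) + Σᵥ (λ v → if does (a ≟ v) then f v else 0)
  ≡⟨ sym (Σ-+ (f [ a ≔ k ]) _) ⟩
    Σᵥ (λ v → (f [ a ≔ k ]) v + (if does (a ≟ v) then f v else 0))
  ≡⟨ Σ-cong exchange ⟩
    Σᵥ (λ v → f v + (if does (a ≟ v) then k else 0))
  ≡⟨ Σ-+ f _ ⟩
    Σᵥ f + Σᵥ (λ v → if does (a ≟ v) then k else 0)
  ≡⟨ cong (Σᵥ f +_) (Σ-point a (λ _ → k)) ⟩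
    Σᵥ f + k
  ∎
  where
    open ≡-Reasoning
    exchange : ∀ v → (f [ a ≔ k ]) v + (if does (a ≟ v) then f v else 0) ≡ f v + (if does (a ≟ v) then k else 0)
    exchange v with a ≟ v
    ... | yes _ = +-comm k (f v)
    ... | no _ = refl

-- Moving the value of a to its neighbour b: if f a = f b = 1 and every
-- neighbour of a is positive, then f with a ↦ 0 and b ↦ 2 is again a Roman
-- {2}-dominating function of the same weight (a is covered by b, and no
-- vertex of value 0 loses anything, since none of them is adjacent to a).
module Shift {n : ℕ} (G : Graph n) {f : Fin n → ℕ} (isR : IsR2DF G f)
             {a b : Fin n} (ab : Adj G a b) (fa : f a ≡ 1) (fb : f b ≡ 1)
             (a-undominated : ¬ (∃[ u ] (Adj G a u × zeros f u ≡ true))) where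

  shifted : Fin n → ℕ
  shifted = (f [ b ≔ 2 ]) [ a ≔ 0 ]

  a≢b : a ≢ b
  a≢b = adj-irrefl G ab

  shifted-b : shifted b ≡ 2
  shifted-b with a ≟ b | b ≟ b
  ... | yes a≡b | _ = contradiction a≡b a≢b
  ... | no _ | yes _ = refl
  ... | no _ | no b≢b = contradiction refl b≢b

  shifted-R2DF : IsR2DF G shifted
  shifted-R2DF = bounded , covered
    where
      bounded : ∀ v → shifted v ≤ 2
      bounded v with a ≟ v
      ... | yes _ = z≤n
      ... | no _ with b ≟ v
      ...   | yes _ = ≤-refl
      ...   | no _ = proj₁ isR v

      grows : ∀ {v} → f v ≡ 0 → ∀ u → Adj G v u → f u ≤ shifted u
      grows {v} fv u vu with a ≟ u
      ... | yes refl = contradiction (v , adj-sym G vu , cong (not ∘ positive) fv) a-undominated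
      ... | no _ with b ≟ u
      ...   | yes _ = proj₁ isR u
      ...   | no _ = ≤-refl

      covered : ∀ v → shifted v ≡ 0 → 2 ≤ nbrSum G shifted v
      covered v sv with a ≟ v
      ... | yes refl = subst (_≤ nbrSum G shifted a) shifted-b (nbrSum-≥ G shifted ab)
      ... | no _ with b ≟ v
      ...   | yes refl = contradiction sv λ ()
      ...   | no _ = ≤-trans (proj₂ isR v sv) (nbrSum-mono G v (grows sv))

  shifted-weight : weight G shifted ≡ weight G f
  shifted-weight = +-cancelʳ-≡ 2 _ _ (begin
      Σᵥ shifted + 2
    ≡⟨ +-assoc (Σᵥ shifted) 1 1 ⟨
      Σᵥ shifted + 1 + 1
    ≡⟨ cong (λ k → Σᵥ shifted + k + 1) middle ⟨
      Σᵥ shifted + (f [ b ≔ 2 ]) a + 1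
    ≡⟨ cong (_+ 1) (trans (weight-update (f [ b ≔ 2 ]) a 0) (+-identityʳ _)) ⟩
      Σᵥ (f [ b ≔ 2 ]) + 1
    ≡⟨ cong (Σᵥ (f [ b ≔ 2 ]) +_) fb ⟨
      Σᵥ (f [ b ≔ 2 ]) + f b
    ≡⟨ weight-update f b 2 ⟩
      Σᵥ f + 2
    ∎)
    where
      open ≡-Reasoning
      middle : (f [ b ≔ 2 ]) a ≡ 1
      middle with b ≟ a
      ... | yes b≡a = contradiction (sym b≡a) a≢b
      ... | no _ = fa

module Extremal {n : ℕ} (G : Graph n) (γ : ℕ) (dom : IsDominationNumber G γ) where

  γ-lower : ∀ S → Dominating G S → γ ≤ size S
  γ-lower = proj₂ dom

  Witnesses : Set
  Witnesses = (∃[ f ] (IsIR2DF G f × weight G f ≡ γ + 1)) ×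
              (∃[ S ] (Dominating G S × Independent G S × size S ≡ γ))

  positive-independent : ∀ {f} → Independent G (support f) → PositiveIndependent G f
  positive-independent independent u v fu fv = independent u v (positive-true fu) (positive-true fv)

  witnesses-from-support : ∀ {f} → IsR2DF G f → weight G f ≡ γ + 1 →
                           Independent G (support f) → size (support f) ≤ γ → Witnesses
  witnesses-from-support {f} isR wt independent small =
    (f , (isR , positive-independent independent) , wt) ,
    (support f , support-dominating G isR , independent ,
     ≤-antisym small (γ-lower _ (support-dominating G isR)))

  -- Then w(f) = |V⁺| + |V₂| forces |V⁺| = γ
  -- and V₂ = {w}; a positive vertex a ≠ w adjacent to another positive vertex
  -- could be deleted from the γ-set V⁺, so V⁺ is independent.
  module ValueTwo {f} (isR : IsR2DF G f) (wt : weight G f ≡ γ + 1) {w} (fw : f w ≡ 2) where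

    D-dominating : Dominating G (support f)
    D-dominating = support-dominating G isR

    split : size (support f) + size (twos f) ≡ γ + 1
    split = trans (sym (weight-support-twos G (proj₁ isR))) wt

    w∈V₂ : twos f w ≡ true
    w∈V₂ rewrite fw = refl

    support-small : size (support f) ≤ γ
    support-small = +-cancelʳ-≤ 1 _ _
      (subst (size (support f) + 1 ≤_) split (+-monoʳ-≤ (size (support f)) (size-pos {S = twos f} w∈V₂)))

    only-w-is-two : ∀ {a} → a ≢ w → f a ≤ 1
    only-w-is-two {a} a≢w with f a in fa | proj₁ isR a
    ... | 0 | _ = z≤n
    ... | 1 | _ = ≤-refl
    ... | suc (suc (suc _)) | s≤s (s≤s ())
    ... | 2 | _ = contradiction
            (subst (γ + 2 ≤_) split (+-mono-≤ (γ-lower _ D-dominating) two-twos))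
            (λ le → m+1+n≰m (γ + 1) {0} (subst (_≤ γ + 1) (sym (+-assoc γ 1 1)) le))
      where
        a∈V₂ : twos f a ≡ true
        a∈V₂ rewrite fa = refl
        w-only : ∀ v → ⁅ w ⁆ v ≡ true → twos f v ≡ true
        w-only v v∈⁅w⁆ with w ≟ v
        ... | yes refl = w∈V₂
        a∉⁅w⁆ : ⁅ w ⁆ a ≡ false
        a∉⁅w⁆ with w ≟ a
        ... | yes w≡a = contradiction (sym w≡a) a≢w
        ... | no _ = refl
        two-twos : 2 ≤ size (twos f)
        two-twos = subst (λ k → k + 1 ≤ size (twos f)) (size-⁅⁆ w) (size-grow w-only a∉⁅w⁆ a∈V₂)

    no-positive-edge : ∀ {a c} → a ≢ w → support f a ≡ true → support f c ≡ true → ¬ Adj G a c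
    no-positive-edge {a} a≢w a⁺ c⁺ ac = m+1+n≰m γ (≤-trans
      (+-monoˡ-≤ 1 (γ-lower _ (support-minus-dominating G isR (only-w-is-two a≢w) ac c⁺)))
      (≤-trans (size-─ {S = support f} a⁺) support-small))

    support-independent : Independent G (support f)
    support-independent a c a⁺ c⁺ ac with a ≟ w
    ... | no a≢w = no-positive-edge a≢w a⁺ c⁺ ac
    ... | yes refl = no-positive-edge (λ c≡a → adj-irrefl G ac (sym c≡a)) c⁺ a⁺ (adj-sym G ac)

    witnesses : Witnesses
    witnesses = witnesses-from-support isR wt support-independent support-small

  -- γ ≥ 1 once G has a vertex v: a γ-set contains v or a neighbour of v.
  γ-positive : Fin n → 1 ≤ γ
  γ-positive v with proj₁ dom
  ... | S , S-dominating , refl with S v in Sv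
  ...   | true = size-pos {S = S} Sv
  ...   | false = size-pos {S = S} (proj₂ (proj₂ (S-dominating v Sv)))

  module ValuesOne {f} (isR : IsR2DF G f) (wt : weight G f ≡ γ + 1) (f≤1 : ∀ v → f v ≤ 1)
                   (conn : Connected G) (acyclic : ¬ HasCycle G) where

    Q : Subset n
    Q = zeros f

    value-one : ∀ {v} → support f v ≡ true → f v ≡ 1
    value-one {v} v⁺ with f v | f≤1 v
    ... | 0 | _ = contradiction v⁺ λ ()
    ... | 1 | _ = refl
    ... | suc (suc _) | s≤s ()

    nonzero-positive : ∀ {v} → Q v ≡ false → support f v ≡ true
    nonzero-positive {v} Qv with positive (f v)
    ... | true = refl

    module Rooted {r} (R : Rooting G r) where
      open Rooting R public
      open RootedSums R

      zeroParentWeight : ℕ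
      zeroParentWeight = Σᵥ (λ u → if Q (parent u) then f u else 0)

      positiveParentWeight : ℕ
      positiveParentWeight = Σᵥ (λ u → if Q (parent u) then 0 else f u)

      weight-by-parent : weight G f ≡ zeroParentWeight + positiveParentWeight
      weight-by-parent = trans (Σ-cong split)
        (Σ-+ (λ u → if Q (parent u) then f u else 0) (λ u → if Q (parent u) then 0 else f u))
        where
          split : ∀ u → f u ≡ (if Q (parent u) then f u else 0) + (if Q (parent u) then 0 else f u)
          split u with Q (parent u)
          ... | true = sym (+-identityʳ (f u))
          ... | false = refl

      -- A vertex x of value 0 needs N_f(x) ≥ 2 but gets at most 1 from its
      -- parent, so its children carry weight ≥ 1, and ≥ 2 if its parent has
      -- value 0 too; summing over x groups the children by their parents.
      zeros-count : size Q + size (λ x → Q x ∧ Q (parent x)) ≤ zeroParentWeight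
      zeros-count = subst (size Q + size (λ x → Q x ∧ Q (parent x)) ≤_) (Σ-fibres parent Q f)
                          (Σ-mono-+ pointwise)
        where
          pointwise : ∀ x → 𝟙 (Q x) + 𝟙 (Q x ∧ Q (parent x)) ≤ (if Q x then childSum f x else 0)
          pointwise x with f x in fx
          ... | suc _ = z≤n
          ... | zero with f (parent x) | f≤1 (parent x)
                        | ≤-trans (proj₂ isR x fx) (nbrSum-parent-children f x)
          ...   | 0 | _ | enough = enough
          ...   | 1 | _ | enough = ≤-pred enough
          ...   | suc (suc _) | s≤s () | _

    HasZeroNeighbour : Fin n → Set
    HasZeroNeighbour v = ∃[ u ] (Adj G v u × Q u ≡ true)

    rooting : ∀ r → Rooting G r
    rooting = TreeRooting.rooting G conn acyclic

    -- Root the tree at a and let Z be the positive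
    -- vertices without a neighbour of value 0. Then Q ∪ Z dominates, |Q| is at
    -- most the weight under parents of value 0, while Z, a and b carry weight
    -- under positive parents; together γ + 2 ≤ w(f) = γ + 1.
    module PositiveEdge {a b} (ab : Adj G a b) (a⁺ : support f a ≡ true) (b⁺ : support f b ≡ true)
                        (a-dom : HasZeroNeighbour a) (b-dom : HasZeroNeighbour b) where
      open Rooted (rooting a)

      Z : Subset n
      Z v = support f v ∧ not (does (dominated? G Q v))

      Z-excludes : ∀ {v} → HasZeroNeighbour v → Z v ≡ false
      Z-excludes {v} dominated with dominated? G Q v
      ... | yes _ = Boolₚ.∧-zeroʳ (support f v)
      ... | no undominated = contradiction dominated undominated

      Z-spec : ∀ {v} → Z v ≡ true → support f v ≡ true × ¬ HasZeroNeighbour v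
      Z-spec {v} Zv with dominated? G Q v | support f v
      ... | no undominated | true = refl , undominated

      QZ-dominating : Dominating G (λ v → Q v ∨ Z v)
      QZ-dominating v v∉ with dominated? G Q v
      ... | yes (u , vu , Qu) = u , vu , cong (_∨ Z u) Qu
      ... | no _ with positive (f v) | v∉
      ...   | true | ()
      ...   | false | ()

      parent-b : parent b ≡ a
      parent-b with edge-parent ab
      ... | inj₁ a≡parent-b = sym a≡parent-b
      ... | inj₂ b≡parent-a = contradiction (trans b≡parent-a parent-root) (λ b≡a → adj-irrefl G ab (sym b≡a))

      under-positive : size Z + 2 ≤ positiveParentWeight
      under-positive =
        subst (λ k → size Z + k ≤ positiveParentWeight)
              (trans (Σ-+ (λ u → 𝟙 (⁅ a ⁆ u)) (λ u → 𝟙 (⁅ b ⁆ u))) (cong₂ _+_ (size-⁅⁆ a) (size-⁅⁆ b)))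
              (Σ-mono-+ pointwise)
        where
          pointwise : ∀ u → 𝟙 (Z u) + (𝟙 (⁅ a ⁆ u) + 𝟙 (⁅ b ⁆ u)) ≤ (if Q (parent u) then 0 else f u)
          pointwise u with a ≟ u | b ≟ u
          ... | yes refl | yes refl = contradiction refl (adj-irrefl G ab)
          ... | yes refl | no _ rewrite Z-excludes a-dom | parent-root | value-one a⁺ = ≤-refl
          ... | no _ | yes refl rewrite Z-excludes b-dom | parent-b | value-one a⁺ | value-one b⁺ = ≤-refl
          ... | no a≢u | no _ with Z u in Zu
          ...   | false = z≤n
          ...   | true with Z-spec Zu | Q (parent u) in Qp
          ...     | _ , undominated | true =
                      contradiction (parent u , parent-adj (λ u≡a → a≢u (sym u≡a)) , Qp) undominated
          ...     | u⁺ , _ | false rewrite value-one u⁺ = ≤-refl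

      impossible : ⊥
      impossible = m+1+n≰m (γ + 1) {0} (begin
          γ + 1 + 1
        ≡⟨ +-assoc γ 1 1 ⟩
          γ + 2
        ≤⟨ +-monoˡ-≤ 2 (≤-trans (γ-lower _ QZ-dominating) (size-∪ Q Z)) ⟩
          size Q + size Z + 2
        ≤⟨ +-monoˡ-≤ 2 (+-monoˡ-≤ (size Z) (≤-trans (m≤m+n (size Q) _) zeros-count)) ⟩
          zeroParentWeight + size Z + 2
        ≡⟨ +-assoc zeroParentWeight (size Z) 2 ⟩
          zeroParentWeight + (size Z + 2)
        ≤⟨ +-monoʳ-≤ zeroParentWeight under-positive ⟩
          zeroParentWeight + positiveParentWeight
        ≡⟨ weight-by-parent ⟨
          weight G f
        ≡⟨ wt ⟩
          γ + 1
        ∎)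
        where open ≤-Reasoning

    -- Every positive vertex has a neighbour (its parent, or any
    -- neighbour of r) and all its neighbours have value 0, so Q dominates; and
    -- |Q| ≤ γ, with |Q| < γ if some vertex of Q had its parent in Q.
    module IndependentSupport (independent : Independent G (support f)) {r} (r⁺ : support f r ≡ true) where
      open Rooted (rooting r)

      zero-neighbour : ∀ {u v} → support f v ≡ true → Adj G v u → Q u ≡ true
      zero-neighbour {u} v⁺ vu with positive (f u) in u⁺
      ... | true = contradiction vu (independent _ _ v⁺ u⁺)
      ... | false = refl

      zero-parents-small : zeroParentWeight ≤ γ
      zero-parents-small = +-cancelʳ-≤ 1 _ _ (begin
          zeroParentWeight + 1
        ≤⟨ +-monoʳ-≤ zeroParentWeight (subst (_≤ positiveParentWeight) (size-⁅⁆ r) (Σ-mono root-term)) ⟩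
          zeroParentWeight + positiveParentWeight
        ≡⟨ weight-by-parent ⟨
          weight G f
        ≡⟨ wt ⟩
          γ + 1
        ∎)
        where
          open ≤-Reasoning
          root-term : ∀ u → 𝟙 (⁅ r ⁆ u) ≤ (if Q (parent u) then 0 else f u)
          root-term u with r ≟ u
          ... | yes refl rewrite parent-root | value-one r⁺ = ≤-refl
          ... | no _ = z≤n

      -- r is not isolated: otherwise G = {r} and w(f) = f r = 1, i.e. γ = 0.
      r-neighbour : ∃[ w ] Adj G r w
      r-neighbour with any? (λ w → adj G r w Boolₚ.≟ true)
      ... | yes neighbour = neighbour
      ... | no isolated = contradiction (subst (1 ≤_) γ≡0 (γ-positive r)) λ ()
        where
          only-r : ∀ u → f u ≡ (if does (r ≟ u) then f u else 0)
          only-r u with r ≟ u | conn r u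
          ... | yes _ | _ = refl
          ... | no r≢u | here = contradiction refl r≢u
          ... | no _ | step ru _ = contradiction (_ , ru) isolated
          γ≡0 : γ ≡ 0
          γ≡0 = +-cancelʳ-≡ 1 γ 0 (trans (sym wt) (trans (Σ-cong only-r) (trans (Σ-point r f) (value-one r⁺))))

      Q-dominating : Dominating G Q
      Q-dominating v Qv with v ≟ r
      ... | yes refl = proj₁ r-neighbour , proj₂ r-neighbour , zero-neighbour r⁺ (proj₂ r-neighbour)
      ... | no v≢r = parent v , parent-adj v≢r , zero-neighbour (nonzero-positive Qv) (parent-adj v≢r)

      no-stacked-zeros : ∀ {z} → Q z ≡ true → Q (parent z) ≡ true → ⊥
      no-stacked-zeros {z} Qz Qpz = m+1+n≰m (size Q) {0} (begin
          size Q + 1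
        ≤⟨ +-monoʳ-≤ (size Q) (size-pos {S = λ x → Q x ∧ Q (parent x)} (cong₂ _∧_ Qz Qpz)) ⟩
          size Q + size (λ x → Q x ∧ Q (parent x))
        ≤⟨ zeros-count ⟩
          zeroParentWeight
        ≤⟨ zero-parents-small ⟩
          γ
        ≤⟨ γ-lower Q Q-dominating ⟩
          size Q
        ∎)
        where open ≤-Reasoning

      Q-independent : Independent G Q
      Q-independent x y Qx Qy xy with edge-parent xy
      ... | inj₁ x≡parent-y = no-stacked-zeros Qy (subst (λ v → Q v ≡ true) x≡parent-y Qx)
      ... | inj₂ y≡parent-x = no-stacked-zeros Qx (subst (λ v → Q v ≡ true) y≡parent-x Qy)

      witnesses : Witnesses
      witnesses =
        (f , (isR , positive-independent independent) , wt) ,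
        (Q , Q-dominating , Q-independent ,
         ≤-antisym (≤-trans (m≤m+n (size Q) _) (≤-trans zeros-count zero-parents-small))
                   (γ-lower Q Q-dominating))

    -- Case 2a, when a positive neighbour is free of 0-neighbours: shift to Case 1.
    shift-to-two : ∀ {a b} → Adj G a b → f a ≡ 1 → f b ≡ 1 → ¬ HasZeroNeighbour a → Witnesses
    shift-to-two ab fa fb a-free = ValueTwo.witnesses shifted-R2DF (trans shifted-weight wt) shifted-b
      where open Shift G isR ab fa fb a-free

    positive-edge : ∀ {a b} → Adj G a b → support f a ≡ true → support f b ≡ true → Witnesses
    positive-edge {a} {b} ab a⁺ b⁺ with dominated? G Q a | dominated? G Q b
    ... | no a-free | _ = shift-to-two ab (value-one a⁺) (value-one b⁺) a-free
    ... | yes _ | no b-free = shift-to-two (adj-sym G ab) (value-one b⁺) (value-one a⁺) b-free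
    ... | yes a-dom | yes b-dom = ⊥-elim (PositiveEdge.impossible ab a⁺ b⁺ a-dom b-dom)

    independent-support : Independent G (support f) → Witnesses
    independent-support independent with any? (λ r → support f r Boolₚ.≟ true)
    ... | yes (r , r⁺) = IndependentSupport.witnesses independent r⁺
    ... | no none = contradiction (trans (sym wt) (trans (Σ-cong vanish) (Σ-zero {n})))
                                  (λ γ+1≡0 → 1+n≢0 (trans (+-comm 1 γ) γ+1≡0))
      where
        vanish : ∀ v → f v ≡ 0
        vanish v with f v in fv
        ... | zero = refl
        ... | suc _ = contradiction (v , cong positive fv) none

    witnesses : Witnesses
    witnesses with any? (λ a → any? (λ b → (support f a Boolₚ.≟ true) ×-dec
                                            ((support f b Boolₚ.≟ true) ×-dec (adj G a b Boolₚ.≟ true))))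
    ... | yes (a , b , a⁺ , b⁺ , ab) = positive-edge ab a⁺ b⁺
    ... | no none = independent-support λ a b a⁺ b⁺ ab → none (a , b , a⁺ , b⁺ , ab)

  witnesses : Connected G → ¬ HasCycle G → ∀ {f} → IsR2DF G f → weight G f ≡ γ + 1 → Witnesses
  witnesses conn acyclic {f} isR wt with any? (λ w → f w ℕ.≟ 2)
    where import Data.Nat as ℕ
  ... | yes (w , fw) = ValueTwo.witnesses isR wt fw
  ... | no no-two = ValuesOne.witnesses isR wt at-most-one conn acyclic
    where
      at-most-one : ∀ v → f v ≤ 1
      at-most-one v with f v | proj₁ isR v | (λ fv → no-two (v , fv))
      ... | 0 | _ | _ = z≤n
      ... | 1 | _ | _ = ≤-refl
      ... | 2 | _ | not-two = contradiction refl not-two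
      ... | suc (suc (suc _)) | s≤s (s≤s ()) | _

corollary16 : ∀ {n} (T : Graph n) → IsTree T →
    ∀ (γ γR2 : ℕ) →
    IsDominationNumber T γ → IsR2DominationNumber T γR2 →
    γR2 ≡ γ + 1 →
    IsIndepR2DominationNumber T γR2 × IsIndepDominationNumber T γ
corollary16 T (_ , conn , acyclic) γ .(γ + 1) dom ((f , isR , wt) , R2-lower) refl
  with Extremal.witnesses T γ dom conn acyclic isR wt
... | independentR2 , independentDominating =
  (independentR2 , λ g g-IR2 → R2-lower g (proj₁ g-IR2)) ,
  (independentDominating , λ S S-dominating _ → Extremal.γ-lower T γ dom S S-dominating)
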